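{- Let $\mathfrak A=\langle A,f,g\rangle$ be a PS-algebra. Then $\mathfrak A$ satisfies "for all $x,y$: $x\neq0\wedge y\neq 0\rightarrow g(x,y)\le f(x,y)$" if and only if $S_g\subseteq Q_f$. In particular, for every betweenness frame $\mathfrak F=\langle U,B\rangle$, in $\mathsf{Cm}^{ps}(\mathfrak F)$ one has $S_{[\![B]\!]}\subseteq Q_{\langle B\rangle}$.
   Context: $A$ is a non-trivial Boolean algebra; a PS-algebra $\langle A,f,g\rangle$ has $f:A^2\to A$ normal ($f(0,y)=f(x,0)=0$) and additive in each argument, and $g:A^2\to A$ with $g(0,y)=g(x,0)=1$ and $g(x+x',y)=g(x,y)\cdot g(x',y)$, $g(x,y+y')=g(x,y)\cdot g(x,y')$. $\mathrm{Ult}(A)$ is the set of ultrafilters of $A$. Ternary relations on $\mathrm{Ult}(A)$: $Q_f(u_1,u_2,u_3)$ iff $f[u_1\times u_3]\subseteq u_2$; $S_g(u_1,u_2,u_3)$ iff $g[u_1\times u_3]\cap u_2\neq\emptyset$. A betweenness frame is $\langle U,B\rangle$, $U\neq\emptyset$, $B\subseteq U^3$ with $B(a,a,a)$, $B(a,b,c)\to B(c,b,a)$, $B(a,b,c)\to B(a,a,b)$, $B(a,b,c)\wedge B(a,c,b)\to b=c$. $\mathsf{Cm}^{ps}(\mathfrak F)=\langle 2^U,\langle B\rangle,[\![B]\!]\rangle$ with $\langle B\rangle(X,Y)=\{u\mid \exists x\in X\,\exists y\in Y\ B(x,u,y)\}$, $[\![B]\!](X,Y)=\{u\mid X\times\{u\}\times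 Y\subseteq B\}$. -}

module Defs where

open import Level using (Level; _⊔_; suc; Lift; lift; lower)
open import Data.Product using (Σ; _×_; _,_; proj₁; proj₂; ∃; ∃-syntax)
open import Data.Sum using (_⊎_; inj₁; inj₂; [_,_])
open import Data.Unit using (tt) renaming (⊤ to Unit)
open import Data.Empty using () renaming (⊥ to Empty; ⊥-elim to Empty-elim)
open import Relation.Nullary using (¬_; yes; no)
open import Relation.Binary.PropositionalEquality using (_≡_)
open import Relation.Binary.Structures using (IsEquivalence)
open import Algebra.Lattice.Bundles using (BooleanAlgebra)
open import Algebra.Lattice.Structures
  using (IsBooleanAlgebra; IsDistributiveLattice; IsLattice)
open import Axiom.ExcludedMiddle using (ExcludedMiddle)

-- Notions relative to a Boolean algebra A (a setoid-based Boolean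
-- algebra from the standard library; join _∨_ = +, meet _∧_ = ·,
-- ⊥ = 0, ⊤ = 1, ¬_ = complement).

module _ {c ℓ : Level} (A : BooleanAlgebra c ℓ) where
  open BooleanAlgebra A renaming (¬_ to -_)

  _≤ᴬ_ : Carrier → Carrier → Set ℓ
  x ≤ᴬ y = (x ∧ y) ≈ x

  NonTrivial : Set ℓ
  NonTrivial = ¬ (⊤ ≈ ⊥)

  record IsUltrafilter (F : Carrier → Set (c ⊔ ℓ)) : Set (c ⊔ ℓ) where
    field
      top-mem     : F ⊤
      bot-notmem  : ¬ F ⊥
      meet-closed : ∀ {x y} → F x → F y → F (x ∧ y)
      up-closed   : ∀ {x y} → x ≤ᴬ y → F x → F y
      ultra       : ∀ x → F x ⊎ F (- x)

  record Ultrafilter : Set (suc (c ⊔ ℓ)) where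
    field
      mem           : Carrier → Set (c ⊔ ℓ)
      isUltrafilter : IsUltrafilter mem

  open Ultrafilter public using (mem)

  -- PS-algebra axioms on a pair of binary operations f, g
  -- (congruence w.r.t. the setoid equality makes f, g genuine functions)
  record IsPS (f g : Carrier → Carrier → Carrier) : Set (c ⊔ ℓ) where
    field
      f-cong      : ∀ {x x′ y y′} → x ≈ x′ → y ≈ y′ → f x y ≈ f x′ y′
      g-cong      : ∀ {x x′ y y′} → x ≈ x′ → y ≈ y′ → g x y ≈ g x′ y′
      f-normalˡ   : ∀ y → f ⊥ y ≈ ⊥
      f-normalʳ   : ∀ x → f x ⊥ ≈ ⊥
      f-additiveˡ : ∀ x x′ y → f (x ∨ x′) y ≈ (f x y ∨ f x′ y)
      f-additiveʳ : ∀ x y y′ → f x (y ∨ y′) ≈ (f x y ∨ f x y′)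
      g-zeroˡ     : ∀ y → g ⊥ y ≈ ⊤
      g-zeroʳ     : ∀ x → g x ⊥ ≈ ⊤
      g-multˡ     : ∀ x x′ y → g (x ∨ x′) y ≈ (g x y ∧ g x′ y)
      g-multʳ     : ∀ x y y′ → g x (y ∨ y′) ≈ (g x y ∧ g x y′)

  Q : (Carrier → Carrier → Carrier) → Ultrafilter → Ultrafilter → Ultrafilter → Set (c ⊔ ℓ)
  Q f u₁ u₂ u₃ = ∀ {x y} → mem u₁ x → mem u₃ y → mem u₂ (f x y)

  S : (Carrier → Carrier → Carrier) → Ultrafilter → Ultrafilter → Ultrafilter → Set (c ⊔ ℓ)
  S g u₁ u₂ u₃ = ∃[ x ] ∃[ y ] (mem u₁ x × mem u₃ y × mem u₂ (g x y))

  _⊆₃_ : (Ultrafilter → Ultrafilter → Ultrafilter → Set (c ⊔ ℓ)) →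
         (Ultrafilter → Ultrafilter → Ultrafilter → Set (c ⊔ ℓ)) → Set (suc (c ⊔ ℓ))
  R ⊆₃ R′ = ∀ u₁ u₂ u₃ → R u₁ u₂ u₃ → R′ u₁ u₂ u₃

record PSAlgebra (c ℓ : Level) : Set (suc (c ⊔ ℓ)) where
  field
    boolAlg    : BooleanAlgebra c ℓ
    nontrivial : NonTrivial boolAlg
    f          : BooleanAlgebra.Carrier boolAlg → BooleanAlgebra.Carrier boolAlg → BooleanAlgebra.Carrier boolAlg
    g          : BooleanAlgebra.Carrier boolAlg → BooleanAlgebra.Carrier boolAlg → BooleanAlgebra.Carrier boolAlg
    isPS       : IsPS boolAlg f g

SatisfiesGF : ∀ {c ℓ} → PSAlgebra c ℓ → Set (c ⊔ ℓ)
SatisfiesGF 𝔄 = ∀ x y → ¬ (x ≈ ⊥) → ¬ (y ≈ ⊥) → _≤ᴬ_ boolAlg (g x y) (f x y)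
  where open PSAlgebra 𝔄
        open BooleanAlgebra boolAlg hiding (¬_)

-- The ultrafilter lemma (part of the classical metatheory of the paper):
-- every non-zero element of a Boolean algebra lies in an ultrafilter.
UltrafilterLemma : (c ℓ : Level) → Set (suc (c ⊔ ℓ))
UltrafilterLemma c ℓ = (A : BooleanAlgebra c ℓ) (x : BooleanAlgebra.Carrier A) →
  ¬ (BooleanAlgebra._≈_ A x (BooleanAlgebra.⊥ A)) →
  Σ (Ultrafilter A) (λ u → mem u x)

record BetweennessFrame (a : Level) : Set (suc a) where
  field
    U        : Set a
    point    : U                     -- U ≠ ∅
    B        : U → U → U → Set a
    B-refl   : ∀ x → B x x x
    B-sym    : ∀ {x y z} → B x y z → B z y x
    B-left   : ∀ {x y z} → B x y z → B x x y
    B-antisym : ∀ {x y z} → B x y z → B x z y → y ≡ z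

-- The power set Boolean algebra 2^U (subsets as predicates U → Set a,
-- equality = extensional equality).  The law X ∪ -X = U is classical,
-- so the construction uses excluded middle.

module PowerSet {a : Level} (lem : ExcludedMiddle a) (U : Set a) where

  Sub : Set (suc a)
  Sub = U → Set a

  _≐_ : Sub → Sub → Set a
  X ≐ Y = ∀ u → (X u → Y u) × (Y u → X u)

  _∪_ _∩_ : Sub → Sub → Sub
  (X ∪ Y) u = X u ⊎ Y u
  (X ∩ Y) u = X u × Y u

  ∁ : Sub → Sub
  ∁ X u = ¬ X u

  Full Empty′ : Sub
  Full _ = Lift a Unit
  Empty′ _ = Lift a Empty

  private
    isEq : IsEquivalence _≐_
    isEq = record
      { refl  = λ u → (λ p → p) , (λ p → p)
      ; sym   = λ e u → proj₂ (e u) , proj₁ (e u)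
      ; trans = λ e e′ u → (λ p → proj₁ (e′ u) (proj₁ (e u) p))
                         , (λ p → proj₂ (e u) (proj₂ (e′ u) p)) }

    ⊎-map : ∀ {P P′ R R′ : Set a} → (P → P′) → (R → R′) → P ⊎ R → P′ ⊎ R′
    ⊎-map h k = [ (λ p → inj₁ (h p)) , (λ r → inj₂ (k r)) ]

    isLat : IsLattice _≐_ _∪_ _∩_
    isLat = record
      { isEquivalence = isEq
      ; ∨-comm  = λ X Y u → [ inj₂ , inj₁ ] , [ inj₂ , inj₁ ]
      ; ∨-assoc = λ X Y Z u →
          [ [ inj₁ , (λ y → inj₂ (inj₁ y)) ] , (λ z → inj₂ (inj₂ z)) ]
        , [ (λ x → inj₁ (inj₁ x)) , [ (λ y → inj₁ (inj₂ y)) , inj₂ ] ]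
      ; ∨-cong  = λ e e′ u → ⊎-map (proj₁ (e u)) (proj₁ (e′ u))
                           , ⊎-map (proj₂ (e u)) (proj₂ (e′ u))
      ; ∧-comm  = λ X Y u → (λ p → proj₂ p , proj₁ p) , (λ p → proj₂ p , proj₁ p)
      ; ∧-assoc = λ X Y Z u →
          (λ p → proj₁ (proj₁ p) , proj₂ (proj₁ p) , proj₂ p)
        , (λ p → (proj₁ p , proj₁ (proj₂ p)) , proj₂ (proj₂ p))
      ; ∧-cong  = λ e e′ u → (λ p → proj₁ (e u) (proj₁ p) , proj₁ (e′ u) (proj₂ p))
                           , (λ p → proj₂ (e u) (proj₁ p) , proj₂ (e′ u) (proj₂ p))
      ; absorptive =
          (λ X Y u → [ (λ x → x) , proj₁ ] , inj₁)
        , (λ X Y u → proj₁ , (λ x → x , inj₁ x))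
      }

    isDL : IsDistributiveLattice _≐_ _∪_ _∩_
    isDL = record
      { isLattice = isLat
      ; ∨-distrib-∧ =
          (λ X Y Z u →
              [ (λ x → inj₁ x , inj₁ x) , (λ p → inj₂ (proj₁ p) , inj₂ (proj₂ p)) ]
            , (λ p → [ inj₁ , (λ y → [ inj₁ , (λ z → inj₂ (y , z)) ] (proj₂ p)) ] (proj₁ p)))
        , (λ X Y Z u →
              [ (λ p → inj₁ (proj₁ p) , inj₁ (proj₂ p)) , (λ x → inj₂ x , inj₂ x) ]
            , (λ p → [ (λ y → [ (λ z → inj₁ (y , z)) , inj₂ ] (proj₂ p)) , inj₂ ] (proj₁ p)))
      ; ∧-distrib-∨ =
          (λ X Y Z u →
              (λ p → [ (λ y → inj₁ (proj₁ p , y)) , (λ z → inj₂ (proj₁ p , z)) ] (proj₂ p))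
            , [ (λ p → proj₁ p , inj₁ (proj₂ p)) , (λ p → proj₁ p , inj₂ (proj₂ p)) ])
        , (λ X Y Z u →
              (λ p → [ (λ y → inj₁ (y , proj₂ p)) , (λ z → inj₂ (z , proj₂ p)) ] (proj₁ p))
            , [ (λ p → inj₁ (proj₁ p) , proj₂ p) , (λ p → inj₂ (proj₁ p) , proj₂ p) ])
      }

    swap : ∀ {P R : Set a} → P ⊎ R → R ⊎ P
    swap = [ inj₂ , inj₁ ]

    em : ∀ (X : Sub) u → X u ⊎ ¬ X u
    em X u with lem {X u}
    ... | yes p = inj₁ p
    ... | no ¬p = inj₂ ¬p

    isBA : IsBooleanAlgebra _≐_ _∪_ _∩_ ∁ Full Empty′
    isBA = record
      { isDistributiveLattice = isDL
      ; ∨-complement =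
          (λ X u → (λ _ → lift tt) , (λ _ → swap (em X u)))
        , (λ X u → (λ _ → lift tt) , (λ _ → em X u))
      ; ∧-complement =
          (λ X u → (λ p → Empty-elim (proj₁ p (proj₂ p))) , (λ ()))
        , (λ X u → (λ p → Empty-elim (proj₂ p (proj₁ p))) , (λ ()))
      ; ¬-cong = λ e u → (λ nx y → nx (proj₂ (e u) y)) , (λ ny x → ny (proj₁ (e u) x))
      }

  powerBA : BooleanAlgebra (suc a) a
  powerBA = record
    { Carrier = Sub ; _≈_ = _≐_ ; _∨_ = _∪_ ; _∧_ = _∩_ ; ¬_ = ∁
    ; ⊤ = Full ; ⊥ = Empty′ ; isBooleanAlgebra = isBA }

module _ {a : Level} (lem : ExcludedMiddle a) (𝔉 : BetweennessFrame a) where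
  open BetweennessFrame 𝔉
  open PowerSet lem U

  ⟨B⟩ : Sub → Sub → Sub
  ⟨B⟩ X Y u = ∃[ x ] ∃[ y ] (X x × Y y × B x u y)

  ⟦B⟧ : Sub → Sub → Sub
  ⟦B⟧ X Y u = ∀ x y → X x → Y y → B x u y

  private
    isPS-Cm : IsPS powerBA ⟨B⟩ ⟦B⟧
    isPS-Cm = record
      { f-cong = λ eX eY u →
          (λ { (x , y , p , q , b) → x , y , proj₁ (eX x) p , proj₁ (eY y) q , b })
        , (λ { (x , y , p , q , b) → x , y , proj₂ (eX x) p , proj₂ (eY y) q , b })
      ; g-cong = λ eX eY u →
          (λ h x y p q → h x y (proj₂ (eX x) p) (proj₂ (eY y) q))
        , (λ h x y p q → h x y (proj₁ (eX x) p) (proj₁ (eY y) q))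
      ; f-normalˡ = λ Y u → (λ { (x , y , () , _) }) , (λ ())
      ; f-normalʳ = λ X u → (λ { (x , y , _ , () , _) }) , (λ ())
      ; f-additiveˡ = λ X X′ Y u →
          (λ { (x , y , inj₁ p , q , b) → inj₁ (x , y , p , q , b)
             ; (x , y , inj₂ p , q , b) → inj₂ (x , y , p , q , b) })
        , [ (λ { (x , y , p , q , b) → x , y , inj₁ p , q , b })
          , (λ { (x , y , p , q , b) → x , y , inj₂ p , q , b }) ]
      ; f-additiveʳ = λ X Y Y′ u →
          (λ { (x , y , p , inj₁ q , b) → inj₁ (x , y , p , q , b)
             ; (x , y , p , inj₂ q , b) → inj₂ (x , y , p , q , b) })
        , [ (λ { (x , y , p , q , b) → x , y , p , inj₁ q , b })
          , (λ { (x , y , p , q , b) → x , y , p , inj₂ q , b }) ]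
      ; g-zeroˡ = λ Y u → (λ _ → lift tt) , (λ _ x y ())
      ; g-zeroʳ = λ X u → (λ _ → lift tt) , (λ _ x y _ ())
      ; g-multˡ = λ X X′ Y u →
          (λ h → (λ x y p q → h x y (inj₁ p) q) , (λ x y p q → h x y (inj₂ p) q))
        , (λ h x y → [ proj₁ h x y , proj₂ h x y ])
      ; g-multʳ = λ X Y Y′ u →
          (λ h → (λ x y p q → h x y p (inj₁ q)) , (λ x y p q → h x y p (inj₂ q)))
        , (λ h x y p → [ proj₁ h x y p , proj₂ h x y p ])
      }

  Cm : PSAlgebra (suc a) a
  Cm = record
    { boolAlg = powerBA
    ; nontrivial = λ e → lower (proj₁ (e point) (lift tt))
    ; f = ⟨B⟩
    ; g = ⟦B⟧
    ; isPS = isPS-Cm }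

{-# OPTIONS --safe #-}

-- If g ≤ f on non-zero arguments, then for x ∈ u₁, y ∈ u₃ with g x y ∈ u₂ and
-- any x′ ∈ u₁, y′ ∈ u₃, shrinking to x ∧ x′ and y ∧ y′ (non-zero, as they lie
-- in ultrafilters) gives g x y ≤ g (x ∧ x′) (y ∧ y′) ≤ f (x ∧ x′) (y ∧ y′) ≤ f x′ y′,
-- so f x′ y′ ∈ u₂.  Conversely, if g x y ≰ f x y then g x y ∧ ¬ f x y ≠ 0, and
-- ultrafilters through x, g x y ∧ ¬ f x y and y witness S_g ⊈ Q_f.  Cm^ps(F)
-- satisfies the inequality since [[B]](X,Y) ⊆ ⟨B⟩(X,Y) whenever X, Y are inhabited.

module Submission where

open import Defs
open import Level using (Level; _⊔_; lift)
open import Data.Product using (_×_; _,_; proj₁; ∃-syntax)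
open import Function.Base using (_∘_)
open import Function.Bundles using (_⇔_; mk⇔)
open import Relation.Nullary using (¬_)
open import Relation.Nullary.Decidable using (decidable-stable)
open import Axiom.ExcludedMiddle using (ExcludedMiddle)
open import Algebra.Core using (Op₂)
open import Algebra.Lattice.Bundles using (BooleanAlgebra)
import Algebra.Lattice.Properties.BooleanAlgebra as BooleanAlgebraProperties
import Algebra.Lattice.Properties.Lattice as LatticeProperties
import Relation.Binary.Lattice as OrderTheoretic
import Relation.Binary.Reasoning.Setoid as SetoidReasoning

module BooleanOrder {c ℓ : Level} (A : BooleanAlgebra c ℓ) where
  open BooleanAlgebra A renaming (¬_ to -_)
  open BooleanAlgebraProperties A
  open SetoidReasoning setoid
  private
    module Natural = OrderTheoretic.Lattice
      (LatticeProperties.∨-∧-orderTheoreticLattice lattice)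

  _≤_ : Carrier → Carrier → Set ℓ
  _≤_ = _≤ᴬ_ A

  ≤-trans : ∀ {x y z} → x ≤ y → y ≤ z → x ≤ z
  ≤-trans x≤y y≤z = sym (Natural.trans (sym x≤y) (sym y≤z))

  ≈⇒≤ : ∀ {x y} → x ≈ y → x ≤ y
  ≈⇒≤ x≈y = sym (Natural.reflexive x≈y)

  x∧y≤x : ∀ x y → (x ∧ y) ≤ x
  x∧y≤x x y = sym (Natural.x∧y≤x x y)

  x∧y≤y : ∀ x y → (x ∧ y) ≤ y
  x∧y≤y x y = sym (Natural.x∧y≤y x y)

  ≤⇒∨≈ʳ : ∀ {x y} → x ≤ y → (x ∨ y) ≈ y
  ≤⇒∨≈ʳ {x} {y} x≤y = begin
    x ∨ y        ≈⟨ ∨-congʳ (sym x≤y) ⟩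
    (x ∧ y) ∨ y  ≈⟨ ∨-comm _ _ ⟩
    y ∨ (x ∧ y)  ≈⟨ ∨-congˡ (∧-comm x y) ⟩
    y ∨ (y ∧ x)  ≈⟨ ∨-absorbs-∧ y x ⟩
    y            ∎

  x∧¬y≈⊥⇒x≤y : ∀ {x y} → (x ∧ - y) ≈ ⊥ → x ≤ y
  x∧¬y≈⊥⇒x≤y {x} {y} x∧¬y≈⊥ = sym (begin
    x                    ≈⟨ sym (∧-identityʳ x) ⟩
    x ∧ ⊤                ≈⟨ ∧-congˡ (sym (∨-complementʳ y)) ⟩
    x ∧ (y ∨ - y)        ≈⟨ ∧-distribˡ-∨ x y (- y) ⟩
    (x ∧ y) ∨ (x ∧ - y)  ≈⟨ ∨-congˡ x∧¬y≈⊥ ⟩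
    (x ∧ y) ∨ ⊥          ≈⟨ ∨-identityʳ _ ⟩
    x ∧ y                ∎)

module UltrafilterProperties {c ℓ : Level} {A : BooleanAlgebra c ℓ}
                             (u : Ultrafilter A) where
  open BooleanAlgebra A renaming (¬_ to -_)
  open BooleanOrder A
  open IsUltrafilter (Ultrafilter.isUltrafilter u) public

  mem⇒≉⊥ : ∀ {x} → mem u x → ¬ x ≈ ⊥
  mem⇒≉⊥ x∈u x≈⊥ = bot-notmem (up-closed (≈⇒≤ x≈⊥) x∈u)

  mem⇒complement∉ : ∀ {x} → mem u x → ¬ mem u (- x)
  mem⇒complement∉ {x} x∈u ¬x∈u =
    bot-notmem (up-closed (≈⇒≤ (∧-complementʳ x)) (meet-closed x∈u ¬x∈u))

module PSOperations {c ℓ : Level} {A : BooleanAlgebra c ℓ}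
                    {f g : Op₂ (BooleanAlgebra.Carrier A)} (isPS : IsPS A f g) where
  open BooleanAlgebra A renaming (¬_ to -_)
  open BooleanOrder A
  open IsPS isPS
  open SetoidReasoning setoid

  f-monoˡ : ∀ {x x′} y → x′ ≤ x → f x′ y ≤ f x y
  f-monoˡ {x} {x′} y x′≤x = begin
    f x′ y ∧ f x y               ≈⟨ ∧-congˡ (f-cong (sym (≤⇒∨≈ʳ x′≤x)) refl) ⟩
    f x′ y ∧ f (x′ ∨ x) y        ≈⟨ ∧-congˡ (f-additiveˡ x′ x y) ⟩
    f x′ y ∧ (f x′ y ∨ f x y)    ≈⟨ ∧-absorbs-∨ _ _ ⟩
    f x′ y                       ∎

  f-monoʳ : ∀ x {y y′} → y′ ≤ y → f x y′ ≤ f x y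
  f-monoʳ x {y} {y′} y′≤y = begin
    f x y′ ∧ f x y               ≈⟨ ∧-congˡ (f-cong refl (sym (≤⇒∨≈ʳ y′≤y))) ⟩
    f x y′ ∧ f x (y′ ∨ y)        ≈⟨ ∧-congˡ (f-additiveʳ x y′ y) ⟩
    f x y′ ∧ (f x y′ ∨ f x y)    ≈⟨ ∧-absorbs-∨ _ _ ⟩
    f x y′                       ∎

  g-antiˡ : ∀ {x x′} y → x′ ≤ x → g x y ≤ g x′ y
  g-antiˡ {x} {x′} y x′≤x = begin
    g x y ∧ g x′ y   ≈⟨ ∧-comm _ _ ⟩
    g x′ y ∧ g x y   ≈⟨ sym (g-multˡ x′ x y) ⟩
    g (x′ ∨ x) y     ≈⟨ g-cong (≤⇒∨≈ʳ x′≤x) refl ⟩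
    g x y            ∎

  g-antiʳ : ∀ x {y y′} → y′ ≤ y → g x y ≤ g x y′
  g-antiʳ x {y} {y′} y′≤y = begin
    g x y ∧ g x y′   ≈⟨ ∧-comm _ _ ⟩
    g x y′ ∧ g x y   ≈⟨ sym (g-multʳ x y′ y) ⟩
    g x (y′ ∨ y)     ≈⟨ g-cong refl (≤⇒∨≈ʳ y′≤y) ⟩
    g x y            ∎

  GBelowF : Set (c ⊔ ℓ)
  GBelowF = ∀ x y → ¬ x ≈ ⊥ → ¬ y ≈ ⊥ → g x y ≤ f x y

  g≤f-below : GBelowF → ∀ {x x′ x″ y y′ y″} →
              x″ ≤ x → x″ ≤ x′ → y″ ≤ y → y″ ≤ y′ → ¬ x″ ≈ ⊥ → ¬ y″ ≈ ⊥ →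
              g x y ≤ f x′ y′
  g≤f-below g≤f {x′ = x′} {x″} {y} {y″ = y″} x″≤x x″≤x′ y″≤y y″≤y′ x″≉⊥ y″≉⊥ =
    g-antiˡ y x″≤x ⟨≤⟩ g-antiʳ x″ y″≤y ⟨≤⟩ g≤f x″ y″ x″≉⊥ y″≉⊥
      ⟨≤⟩ f-monoˡ y″ x″≤x′ ⟨≤⟩ f-monoʳ x′ y″≤y′
    where
    infixr 4 _⟨≤⟩_
    _⟨≤⟩_ : ∀ {p q r} → p ≤ q → q ≤ r → p ≤ r
    _⟨≤⟩_ = ≤-trans

  GBelowF⇒S⊆Q : GBelowF → _⊆₃_ A (S A g) (Q A f)
  GBelowF⇒S⊆Q g≤f u₁ u₂ u₃ (x , y , x∈u₁ , y∈u₃ , gxy∈u₂) {x′} {y′} x′∈u₁ y′∈u₃ =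
    U₂.up-closed
      (g≤f-below g≤f (x∧y≤x x x′) (x∧y≤y x x′) (x∧y≤x y y′) (x∧y≤y y y′)
        (U₁.mem⇒≉⊥ (U₁.meet-closed x∈u₁ x′∈u₁))
        (U₃.mem⇒≉⊥ (U₃.meet-closed y∈u₃ y′∈u₃)))
      gxy∈u₂
    where
    module U₁ = UltrafilterProperties u₁
    module U₂ = UltrafilterProperties u₂
    module U₃ = UltrafilterProperties u₃

  S⊆Q⇒GBelowF : ExcludedMiddle ℓ → UltrafilterLemma c ℓ →
                _⊆₃_ A (S A g) (Q A f) → GBelowF
  S⊆Q⇒GBelowF lem ultrafilter S⊆Q x y x≉⊥ y≉⊥ = decidable-stable lem λ g≰f →
    let z = g x y ∧ - f x y
        u₁ , x∈u₁ = ultrafilter A x x≉⊥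
        u₂ , z∈u₂ = ultrafilter A z (g≰f ∘ x∧¬y≈⊥⇒x≤y)
        u₃ , y∈u₃ = ultrafilter A y y≉⊥
        module U₂ = UltrafilterProperties u₂
        S₁₂₃ = x , y , x∈u₁ , y∈u₃ , U₂.up-closed (x∧y≤x _ _) z∈u₂
    in U₂.mem⇒complement∉ (S⊆Q u₁ u₂ u₃ S₁₂₃ x∈u₁ y∈u₃) (U₂.up-closed (x∧y≤y _ _) z∈u₂)

module ComplexAlgebra {a : Level} (lem : ExcludedMiddle a) (𝔉 : BetweennessFrame a) where
  open BetweennessFrame 𝔉
  open PowerSet lem U

  ≉∅⇒inhabited : ∀ X → ¬ X ≐ Empty′ → ∃[ x ] X x
  ≉∅⇒inhabited X X≉∅ = decidable-stable lem λ X-uninhabited →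
    X≉∅ λ u → (λ u∈X → lift (X-uninhabited (u , u∈X))) , λ ()

  ⟦B⟧⊆⟨B⟩ : ∀ {X Y} → ∃[ x ] X x → ∃[ y ] Y y →
            ∀ {u} → ⟦B⟧ lem 𝔉 X Y u → ⟨B⟩ lem 𝔉 X Y u
  ⟦B⟧⊆⟨B⟩ (x , x∈X) (y , y∈Y) Bxuy = x , y , x∈X , y∈Y , Bxuy x y x∈X y∈Y

  Cm-satisfiesGF : SatisfiesGF (Cm lem 𝔉)
  Cm-satisfiesGF X Y X≉∅ Y≉∅ u =
    proj₁ , λ u∈⟦B⟧ →
      u∈⟦B⟧ , ⟦B⟧⊆⟨B⟩ (≉∅⇒inhabited X X≉∅) (≉∅⇒inhabited Y Y≉∅) u∈⟦B⟧

  Cm-S⊆Q : _⊆₃_ powerBA (S powerBA (⟦B⟧ lem 𝔉)) (Q powerBA (⟨B⟩ lem 𝔉))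
  Cm-S⊆Q = PSOperations.GBelowF⇒S⊆Q (PSAlgebra.isPS (Cm lem 𝔉)) Cm-satisfiesGF

lemma7p1 : {c ℓ a : Level} → ExcludedMiddle ℓ → UltrafilterLemma c ℓ →
    ((𝔄 : PSAlgebra c ℓ) →
      SatisfiesGF 𝔄 ⇔ _⊆₃_ (PSAlgebra.boolAlg 𝔄) (S (PSAlgebra.boolAlg 𝔄) (PSAlgebra.g 𝔄)) (Q (PSAlgebra.boolAlg 𝔄) (PSAlgebra.f 𝔄)))
    × ((lem : ExcludedMiddle a) (𝔉 : BetweennessFrame a) →
      _⊆₃_ (PSAlgebra.boolAlg (Cm lem 𝔉)) (S (PSAlgebra.boolAlg (Cm lem 𝔉)) (PSAlgebra.g (Cm lem 𝔉))) (Q (PSAlgebra.boolAlg (Cm lem 𝔉)) (PSAlgebra.f (Cm lem 𝔉))))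
lemma7p1 {c} {ℓ} lem ultrafilter = g≤f⇔S⊆Q , ComplexAlgebra.Cm-S⊆Q
  where
  g≤f⇔S⊆Q : (𝔄 : PSAlgebra c ℓ) → let open PSAlgebra 𝔄 in
            SatisfiesGF 𝔄 ⇔ _⊆₃_ boolAlg (S boolAlg g) (Q boolAlg f)
  g≤f⇔S⊆Q 𝔄 = mk⇔ GBelowF⇒S⊆Q (S⊆Q⇒GBelowF lem ultrafilter)
    where open PSOperations (PSAlgebra.isPS 𝔄)
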